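{- Let $G$ be a finite simple undirected graph. Let $\omega(G)$ denote the maximum number of vertices in a clique of $G$ and $\omega'(G):=\binom{\omega(G)}{2}$ the number of edges of a maximum clique of $G$. Then every clique partition $\mathcal{X}$ of $G$ that can be returned by the algorithm \textsc{Greedy Edmonds} (for any choices of maximum cliques and maximum matchings made during its execution) satisfies \[ \mathsf{OPT} \leq \frac{2\omega'(G)}{\omega'(G)+1}\,|E(\mathcal{X})|, \] where $\mathsf{OPT}$ is the maximum of $|E(\mathcal{Y})|$ over all clique partitions $\mathcal{Y}$ of $G$.
   Context: A clique of a graph is a set of pairwise adjacent vertices. A clique partition of $G$ is a partition of $V(G)$ into cliques of $G$; for a clique partition $\mathcal{X}$, $E(\mathcal{X})$ denotes the set of edges of $G$ with both ends in the same part of $\mathcal{X}$. The algorithm \textsc{Greedy Edmonds} on input $G$ is: set $\mathcal{X}=\emptyset$; while $G$ has at least one vertex: if $\omega(G)=2$, compute a maximum matching $\mathcal{M}$ of $G$, add each edge of $\mathcal{M}$ (as a 2-vertex clique) to $\mathcal{X}$, and replace $G$ by $G-V(\mathcal{M})$; otherwise, compute a maximum clique $X$ of $G$ (a clique of size $\omega(G)$), add $X$ to $\mathcal{X}$, and replace $G$ by $G-X$. Output $\mathcal{X}$. -}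

module Defs where

open import Data.Nat using (ℕ; zero; suc; _≤_; _+_; _<_)
open import Data.Nat.Combinatorics using (_C_)
open import Data.Fin using (Fin; toℕ)
open import Data.Fin.Subset using (Subset; _∈_; _⊆_; _∪_; _─_; ∣_∣; ⁅_⁆; ⊥; ⊤; Nonempty)
open import Data.Fin.Subset.Properties using (_∈?_)
open import Data.List using (List; []; _∷_; length; filter; concatMap; map; foldr; _++_; allFin; cartesianProduct)
open import Data.List.Relation.Unary.All using (All)
open import Data.List.Relation.Unary.Any using (Any; any?)
open import Data.List.Relation.Unary.Unique.Propositional using (Unique)
open import Data.Product using (Σ; _×_; _,_; proj₁; proj₂)
open import Relation.Binary.PropositionalEquality using (_≡_; _≢_)
open import Relation.Nullary using (¬_; Dec)
open import Relation.Nullary.Decidable using (_×-dec_)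
open import Relation.Binary using (Decidable)
open import Data.Nat.Properties using (_<?_)

record Graph (n : ℕ) : Set₁ where
  field
    Adj    : Fin n → Fin n → Set
    adj?   : Decidable Adj
    sym    : ∀ {u v} → Adj u v → Adj v u
    irrefl : ∀ {u} → ¬ Adj u u
open Graph public

module _ {n : ℕ} (G : Graph n) where

  IsClique : Subset n → Set
  IsClique X = ∀ u v → u ∈ X → v ∈ X → u ≢ v → Adj G u v

  IsCliqueNumberOf : Subset n → ℕ → Set
  IsCliqueNumberOf S k =
    Σ (Subset n) (λ X → X ⊆ S × IsClique X × ∣ X ∣ ≡ k)
    × (∀ X → X ⊆ S → IsClique X → ∣ X ∣ ≤ k)

  IsMaxCliqueIn : Subset n → Subset n → Set
  IsMaxCliqueIn S X = X ⊆ S × IsClique X × IsCliqueNumberOf S ∣ X ∣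

  endpoints : List (Fin n × Fin n) → List (Fin n)
  endpoints = concatMap (λ e → proj₁ e ∷ proj₂ e ∷ [])

  IsMatchingIn : Subset n → List (Fin n × Fin n) → Set
  IsMatchingIn S M =
    All (λ e → Adj G (proj₁ e) (proj₂ e) × proj₁ e ∈ S × proj₂ e ∈ S) M
    × Unique (endpoints M)

  IsMaxMatchingIn : Subset n → List (Fin n × Fin n) → Set
  IsMaxMatchingIn S M =
    IsMatchingIn S M × (∀ M' → IsMatchingIn S M' → length M' ≤ length M)

  vertexSet : List (Fin n × Fin n) → Subset n
  vertexSet = foldr (λ e A → ⁅ proj₁ e ⁆ ∪ ⁅ proj₂ e ⁆ ∪ A) ⊥

  edgeParts : List (Fin n × Fin n) → List (Subset n)
  edgeParts = map (λ e → ⁅ proj₁ e ⁆ ∪ ⁅ proj₂ e ⁆)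

  -- GreedyEdmonds S 𝒳 : 𝒳 is a possible output of Greedy Edmonds
  -- run on the induced subgraph G[S] (for some choices of maximum cliques
  -- and maximum matchings).
  data GreedyEdmonds : Subset n → List (Subset n) → Set where
    done     : ∀ {S} → ¬ Nonempty S → GreedyEdmonds S []
    matching : ∀ {S M 𝒳} → Nonempty S → IsCliqueNumberOf S 2 →
               IsMaxMatchingIn S M →
               GreedyEdmonds (S ─ vertexSet M) 𝒳 →
               GreedyEdmonds S (edgeParts M ++ 𝒳)
    clique   : ∀ {S X 𝒳} → Nonempty S → ¬ IsCliqueNumberOf S 2 →
               IsMaxCliqueIn S X →
               GreedyEdmonds (S ─ X) 𝒳 →
               GreedyEdmonds S (X ∷ 𝒳)

  IsCliquePartition : List (Subset n) → Set
  IsCliquePartition 𝒴 =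
    All (λ X → IsClique X × Nonempty X) 𝒴
    × (∀ v → length (filter (v ∈?_) 𝒴) ≡ 1)

  sameEdge? : (𝒳 : List (Subset n)) → (p : Fin n × Fin n) →
              Dec ((toℕ (proj₁ p) < toℕ (proj₂ p)) × Adj G (proj₁ p) (proj₂ p)
                   × Any (λ X → proj₁ p ∈ X × proj₂ p ∈ X) 𝒳)
  sameEdge? 𝒳 (u , v) =
    (toℕ u <? toℕ v) ×-dec (adj? G u v ×-dec any? (λ X → (u ∈? X) ×-dec (v ∈? X)) 𝒳)

  numEdges : List (Subset n) → ℕ
  numEdges 𝒳 = length (filter (sameEdge? 𝒳) (cartesianProduct (allFin n) (allFin n)))

-- Fix an optimal clique partition 𝒴 and, while S is the set of vertices not yet covered, give each part
-- Q the weight ∣Q ∩ S∣ C 2 + 1 if ∣Q ∩ S∣ ≥ 2 and 0 otherwise. The potential of S, the total weight, is at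
-- most twice the number of edges that a run of Greedy Edmonds on S collects. A maximum clique X of size
-- k ≠ 2 meets each part in a ≤ k vertices and lowers its weight by at most (k − 1) a, so the potential
-- drops by at most k (k − 1) = 2 (k C 2), twice the edges X contributes. When the clique number is 2,
-- every part meets S in at most 2 vertices, so the parts' edges inside S form a matching and the potential
-- is at most twice the size of a maximum matching. Finally every part has r C 2 ≤ ω′ edges, so
-- (ω′ + 1) (r C 2) ≤ ω′ (r C 2 + 1); summing over 𝒴 gives (ω′ + 1) OPT ≤ ω′ · potential ≤ 2 ω′ ∣E(𝒳)∣.

module Submission where

open import Defs
open import Level using (Level)
open import Data.Nat using (ℕ; zero; suc; _+_; _*_; _∸_; _≤_; _<_; z≤n; s≤s)
open import Data.Nat.Properties hiding (_≟_)
open import Data.Nat.Combinatorics using (_C_; nC1≡n; nCk+nC[k+1]≡[n+1]C[k+1])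
open import Data.Fin using (Fin; zero; suc; toℕ; _≟_)
import Data.Fin.Properties as Fin
open import Data.Fin.Subset using (Subset; _∈_; _∉_; _⊆_; _∩_; _∪_; _─_; _-_; ∣_∣; inside; outside; ⊤; ⁅_⁆; Empty)
open import Data.Fin.Subset.Properties using (_∈?_; drop-there; x∈p∩q⁺; x∈p∩q⁻; x∈p∪q⁺; x∈p∪q⁻; p─q⊆p; x∈⁅x⁆; x∈⁅y⁆⇒x≡y; p∩q⊆q; ∈⊤; drop-∷-⊆; x∈p∧x≢y⇒x∈p-y; x∈p⇒∣p-x∣<∣p∣; Empty-unique; ∩-zeroʳ; ∣⊥∣≡0)
open import Data.Vec.Base using ([]; _∷_; here; there)
open import Data.List using (List; []; _∷_; length; filter; map; _++_; allFin; tabulate; cartesianProduct)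
open import Data.List.Relation.Unary.All as All using (All; []; _∷_)
open import Data.List.Relation.Unary.Any as Any using (Any; here; there; any?)
open import Data.List.Relation.Unary.All.Properties using (All¬⇒¬Any; ++⁺; all-filter)
open import Data.List.Relation.Unary.Any.Properties using (++⁺ˡ)
open import Data.List.Relation.Unary.Unique.Propositional using (Unique)
open import Data.List.Relation.Unary.Unique.Propositional.Properties using (cartesianProduct⁺; allFin⁺) renaming (filter⁺ to Unique-filter⁺)
open import Data.List.Relation.Unary.AllPairs as AllPairs using (AllPairs; []; _∷_)
import Data.List.Membership.Propositional as List
open import Data.Product using (_×_; _,_; proj₁; proj₂)
open import Data.Sum using (_⊎_; inj₁; inj₂; [_,_])
open import Data.Empty using (⊥-elim)
open import Function using (_∘_)
open import Relation.Binary.PropositionalEquality as ≡ using (_≡_; _≢_; refl; ≢-sym; cong; cong₂; subst; module ≡-Reasoning)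
open import Relation.Nullary using (¬_; Dec; yes; no)
open import Relation.Nullary.Decidable using (_×-dec_)
import Relation.Unary as U
open import Algebra.Properties.CommutativeSemigroup +-commutativeSemigroup using (interchange)

private variable
  a b p q r : Level
  A : Set a
  B : Set b

∑ : List A → (A → ℕ) → ℕ
∑ []       f = 0
∑ (x ∷ xs) f = f x + ∑ xs f

syntax ∑ xs (λ x → e) = ∑[ x ← xs ] e

∑-cong : ∀ (xs : List A) {f g : A → ℕ} → (∀ x → f x ≡ g x) → ∑ xs f ≡ ∑ xs g
∑-cong []       f≡g = refl
∑-cong (x ∷ xs) f≡g = cong₂ _+_ (f≡g x) (∑-cong xs f≡g)

∑-mono : ∀ (xs : List A) {f g : A → ℕ} → (∀ x → f x ≤ g x) → ∑ xs f ≤ ∑ xs g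
∑-mono []       f≤g = z≤n
∑-mono (x ∷ xs) f≤g = +-mono-≤ (f≤g x) (∑-mono xs f≤g)

∑-mono-All : ∀ {P : A → Set p} {xs : List A} {f g : A → ℕ} →
             All P xs → (∀ {x} → P x → f x ≤ g x) → ∑ xs f ≤ ∑ xs g
∑-mono-All []         f≤g = z≤n
∑-mono-All (px ∷ pxs) f≤g = +-mono-≤ (f≤g px) (∑-mono-All pxs f≤g)

∑-zero : ∀ (xs : List A) → ∑[ x ← xs ] 0 ≡ 0
∑-zero []       = refl
∑-zero (x ∷ xs) = ∑-zero xs

∑-distrib-+ : ∀ (xs : List A) (f g : A → ℕ) → ∑[ x ← xs ] (f x + g x) ≡ ∑ xs f + ∑ xs g
∑-distrib-+ []       f g = refl
∑-distrib-+ (x ∷ xs) f g = begin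
  f x + g x + ∑[ y ← xs ] (f y + g y) ≡⟨ cong (f x + g x +_) (∑-distrib-+ xs f g) ⟩
  f x + g x + (∑ xs f + ∑ xs g)       ≡⟨ interchange (f x) (g x) (∑ xs f) (∑ xs g) ⟩
  f x + ∑ xs f + (g x + ∑ xs g)       ∎
  where open ≡-Reasoning

∑-distribˡ-* : ∀ (xs : List A) (c : ℕ) (f : A → ℕ) → ∑[ x ← xs ] (c * f x) ≡ c * ∑ xs f
∑-distribˡ-* []       c f = ≡.sym (*-zeroʳ c)
∑-distribˡ-* (x ∷ xs) c f = begin
  c * f x + ∑[ y ← xs ] (c * f y) ≡⟨ cong (c * f x +_) (∑-distribˡ-* xs c f) ⟩
  c * f x + c * ∑ xs f            ≡⟨ *-distribˡ-+ c (f x) (∑ xs f) ⟨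
  c * (f x + ∑ xs f)              ∎
  where open ≡-Reasoning

∑-++ : ∀ (xs ys : List A) (f : A → ℕ) → ∑ (xs ++ ys) f ≡ ∑ xs f + ∑ ys f
∑-++ []       ys f = refl
∑-++ (x ∷ xs) ys f = begin
  f x + ∑ (xs ++ ys) f       ≡⟨ cong (f x +_) (∑-++ xs ys f) ⟩
  f x + (∑ xs f + ∑ ys f)    ≡⟨ +-assoc (f x) (∑ xs f) (∑ ys f) ⟨
  f x + ∑ xs f + ∑ ys f      ∎
  where open ≡-Reasoning

∑-map : ∀ (g : B → A) (xs : List B) (f : A → ℕ) → ∑ (map g xs) f ≡ ∑ xs (f ∘ g)
∑-map g []       f = refl
∑-map g (x ∷ xs) f = cong (f (g x) +_) (∑-map g xs f)

∑-comm : ∀ (xs : List A) (ys : List B) (f : A → B → ℕ) →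
         ∑[ x ← xs ] ∑ ys (f x) ≡ ∑[ y ← ys ] ∑[ x ← xs ] f x y
∑-comm []       ys f = ≡.sym (∑-zero ys)
∑-comm (x ∷ xs) ys f = begin
  ∑ ys (f x) + ∑[ x′ ← xs ] ∑ ys (f x′)         ≡⟨ cong (∑ ys (f x) +_) (∑-comm xs ys f) ⟩
  ∑ ys (f x) + ∑[ y ← ys ] ∑[ x′ ← xs ] f x′ y  ≡⟨ ∑-distrib-+ ys (f x) _ ⟨
  ∑[ y ← ys ] (f x y + ∑[ x′ ← xs ] f x′ y)     ∎
  where open ≡-Reasoning

∑-cartesianProduct : ∀ (xs : List A) (ys : List B) (f : A × B → ℕ) →
                     ∑ (cartesianProduct xs ys) f ≡ ∑[ x ← xs ] ∑[ y ← ys ] f (x , y)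
∑-cartesianProduct []       ys f = refl
∑-cartesianProduct (x ∷ xs) ys f = begin
  ∑ (map (x ,_) ys ++ cartesianProduct xs ys) f          ≡⟨ ∑-++ (map (x ,_) ys) _ f ⟩
  ∑ (map (x ,_) ys) f + ∑ (cartesianProduct xs ys) f     ≡⟨ cong₂ _+_ (∑-map (x ,_) ys f) (∑-cartesianProduct xs ys f) ⟩
  ∑[ y ← ys ] f (x , y) + ∑[ x′ ← xs ] ∑[ y ← ys ] f (x′ , y)   ∎
  where open ≡-Reasoning

∑-tabulate : ∀ n (g : Fin n → A) (f : A → ℕ) → ∑ (tabulate g) f ≡ ∑ (allFin n) (f ∘ g)
∑-tabulate zero    g f = refl
∑-tabulate (suc n) g f = cong (f (g zero) +_) (begin
  ∑ (tabulate (g ∘ suc)) f        ≡⟨ ∑-tabulate n (g ∘ suc) f ⟩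
  ∑ (allFin n) (f ∘ g ∘ suc)      ≡⟨ ∑-tabulate n suc (f ∘ g) ⟨
  ∑ (tabulate suc) (f ∘ g)        ∎)
  where open ≡-Reasoning

∑-allFin-suc : ∀ n (f : Fin (suc n) → ℕ) → ∑ (allFin (suc n)) f ≡ f zero + ∑ (allFin n) (f ∘ suc)
∑-allFin-suc n f = cong (f zero +_) (∑-tabulate n suc f)

𝟙 : {P : Set p} → Dec P → ℕ
𝟙 (yes _) = 1
𝟙 (no _)  = 0

𝟙-yes : {P : Set p} (P? : Dec P) → P → 𝟙 P? ≡ 1
𝟙-yes (yes _) _  = refl
𝟙-yes (no ¬P) pr = ⊥-elim (¬P pr)

𝟙-no : {P : Set p} (P? : Dec P) → ¬ P → 𝟙 P? ≡ 0
𝟙-no (yes pr) ¬P = ⊥-elim (¬P pr)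
𝟙-no (no _)   _  = refl

𝟙-mono : {P : Set p} {Q : Set q} (P? : Dec P) (Q? : Dec Q) → (P → Q) → 𝟙 P? ≤ 𝟙 Q?
𝟙-mono (yes pr) Q? P⇒Q = ≤-reflexive (≡.sym (𝟙-yes Q? (P⇒Q pr)))
𝟙-mono (no _)   Q? P⇒Q = z≤n

𝟙-cong : {P : Set p} {Q : Set q} (P? : Dec P) (Q? : Dec Q) → (P → Q) → (Q → P) → 𝟙 P? ≡ 𝟙 Q?
𝟙-cong P? Q? P⇒Q Q⇒P = ≤-antisym (𝟙-mono P? Q? P⇒Q) (𝟙-mono Q? P? Q⇒P)

𝟙-disjoint : {P : Set p} {Q : Set q} {R : Set r} (P? : Dec P) (Q? : Dec Q) (R? : Dec R) →
             ¬ (P × Q) → (P → R) → (Q → R) → 𝟙 P? + 𝟙 Q? ≤ 𝟙 R?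
𝟙-disjoint (yes pr) (yes qr) R? ¬P×Q P⇒R Q⇒R = ⊥-elim (¬P×Q (pr , qr))
𝟙-disjoint (yes pr) (no _)   R? ¬P×Q P⇒R Q⇒R = ≤-reflexive (≡.sym (𝟙-yes R? (P⇒R pr)))
𝟙-disjoint (no _)   Q?       R? ¬P×Q P⇒R Q⇒R = 𝟙-mono Q? R? Q⇒R

length-filter≡∑𝟙 : ∀ {P : A → Set p} (P? : U.Decidable P) (xs : List A) →
                   length (filter P? xs) ≡ ∑[ x ← xs ] 𝟙 (P? x)
length-filter≡∑𝟙 P? []       = refl
length-filter≡∑𝟙 P? (x ∷ xs) with P? x
... | yes _ = cong suc (length-filter≡∑𝟙 P? xs)
... | no _  = length-filter≡∑𝟙 P? xs

module _ {P : A → Set p} (P? : U.Decidable P) where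

  Any⇒1≤∑𝟙 : ∀ {xs} → Any P xs → 1 ≤ ∑[ x ← xs ] 𝟙 (P? x)
  Any⇒1≤∑𝟙 {x ∷ xs} (here px)   = ≤-trans (≤-reflexive (≡.sym (𝟙-yes (P? x) px))) (m≤m+n _ _)
  Any⇒1≤∑𝟙 {x ∷ xs} (there pxs) = ≤-trans (Any⇒1≤∑𝟙 pxs) (m≤n+m _ (𝟙 (P? x)))

  ¬Any⇒∑𝟙≡0 : ∀ {xs} → ¬ Any P xs → ∑[ x ← xs ] 𝟙 (P? x) ≡ 0
  ¬Any⇒∑𝟙≡0 {[]}     ¬any = refl
  ¬Any⇒∑𝟙≡0 {x ∷ xs} ¬any =
    cong₂ _+_ (𝟙-no (P? x) (¬any ∘ here)) (¬Any⇒∑𝟙≡0 (¬any ∘ there))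

  𝟙-Any≤∑𝟙 : ∀ {xs} (D : Dec (Any P xs)) → 𝟙 D ≤ ∑[ x ← xs ] 𝟙 (P? x)
  𝟙-Any≤∑𝟙 (yes any) = Any⇒1≤∑𝟙 any
  𝟙-Any≤∑𝟙 (no _)    = z≤n

  ∑𝟙≤𝟙-Any : ∀ {xs} (D : Dec (Any P xs)) → ∑[ x ← xs ] 𝟙 (P? x) ≤ 1 → ∑[ x ← xs ] 𝟙 (P? x) ≤ 𝟙 D
  ∑𝟙≤𝟙-Any (yes _)   ∑≤1 = ∑≤1
  ∑𝟙≤𝟙-Any (no ¬any) ∑≤1 = ≤-reflexive (¬Any⇒∑𝟙≡0 ¬any)

  P+Any⇒2≤∑𝟙 : ∀ {x xs} → P x → Any P xs → 2 ≤ ∑[ y ← x ∷ xs ] 𝟙 (P? y)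
  P+Any⇒2≤∑𝟙 {x} px pxs = +-mono-≤ (≤-reflexive (≡.sym (𝟙-yes (P? x) px))) (Any⇒1≤∑𝟙 pxs)

  ∑𝟙≤1⇒Any-× : ∀ {A′ B′ : A → Set q} {xs} → ∑[ x ← xs ] 𝟙 (P? x) ≤ 1 →
               (∀ {x} → A′ x → P x) → (∀ {x} → B′ x → P x) →
               Any A′ xs → Any B′ xs → Any (λ x → A′ x × B′ x) xs
  ∑𝟙≤1⇒Any-× ∑≤1 A⇒P B⇒P (here a)  (here b)  = here (a , b)
  ∑𝟙≤1⇒Any-× ∑≤1 A⇒P B⇒P (here a)  (there b) = ⊥-elim (1+n≰n (≤-trans (P+Any⇒2≤∑𝟙 (A⇒P a) (Any.map B⇒P b)) ∑≤1))
  ∑𝟙≤1⇒Any-× ∑≤1 A⇒P B⇒P (there a) (here b)  = ⊥-elim (1+n≰n (≤-trans (P+Any⇒2≤∑𝟙 (B⇒P b) (Any.map A⇒P a)) ∑≤1))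
  ∑𝟙≤1⇒Any-× {xs = x ∷ xs} ∑≤1 A⇒P B⇒P (there a) (there b) =
    there (∑𝟙≤1⇒Any-× (≤-trans (m≤n+m _ (𝟙 (P? x))) ∑≤1) A⇒P B⇒P a b)

suc-C2 : ∀ m → suc m C 2 ≡ m + m C 2
suc-C2 m = begin
  suc m C 2         ≡⟨ nCk+nC[k+1]≡[n+1]C[k+1] m 1 ⟨
  m C 1 + m C 2     ≡⟨ cong (_+ m C 2) (nC1≡n m) ⟩
  m + m C 2         ∎
  where open ≡-Reasoning

C2-mono : ∀ {m n} → m ≤ n → m C 2 ≤ n C 2
C2-mono {zero}  {n}     z≤n       = z≤n
C2-mono {suc m} {suc n} (s≤s m≤n) = begin
  suc m C 2     ≡⟨ suc-C2 m ⟩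
  m + m C 2     ≤⟨ +-mono-≤ m≤n (C2-mono m≤n) ⟩
  n + n C 2     ≡⟨ suc-C2 n ⟨
  suc n C 2     ∎
  where open ≤-Reasoning

2*C2≡*pred : ∀ m → 2 * (m C 2) ≡ m * (m ∸ 1)
2*C2≡*pred zero          = refl
2*C2≡*pred (suc zero)    = refl
2*C2≡*pred (suc (suc m)) = begin
  2 * (suc (suc m) C 2)          ≡⟨ cong (2 *_) (suc-C2 (suc m)) ⟩
  2 * (suc m + suc m C 2)        ≡⟨ *-distribˡ-+ 2 (suc m) (suc m C 2) ⟩
  2 * suc m + 2 * (suc m C 2)    ≡⟨ cong (2 * suc m +_) (2*C2≡*pred (suc m)) ⟩
  2 * suc m + suc m * m          ≡⟨ cong (2 * suc m +_) (*-comm (suc m) m) ⟩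
  2 * suc m + m * suc m          ≡⟨ *-distribʳ-+ (suc m) 2 m ⟨
  suc (suc m) * suc m            ∎
  where open ≡-Reasoning

weight : ℕ → ℕ
weight 0             = 0
weight 1             = 0
weight (suc (suc m)) = suc (suc (suc m) C 2)

weight≤1≡0 : ∀ {r} → r ≤ 1 → weight r ≡ 0
weight≤1≡0 z≤n       = refl
weight≤1≡0 (s≤s z≤n) = refl

weight-suc≤ : ∀ {k} m → 2 ≤ k → m ≤ k → weight (suc m) ≤ k + weight m
weight-suc≤     zero          2≤k m≤k = z≤n
weight-suc≤ {k} (suc zero)    2≤k m≤k = ≤-trans 2≤k (m≤m+n k 0)
weight-suc≤ {k} (suc (suc m)) 2≤k m≤k = begin
  suc (suc (suc (suc m)) C 2)            ≡⟨ cong suc (suc-C2 (suc (suc m))) ⟩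
  suc (suc (suc m) + suc (suc m) C 2)    ≤⟨ s≤s (+-monoˡ-≤ _ m≤k) ⟩
  suc (k + suc (suc m) C 2)              ≡⟨ +-suc k _ ⟨
  k + weight (suc (suc m))               ∎
  where open ≤-Reasoning

weight-+≤ : ∀ {c} a b → 2 ≤ c → a + b ≤ suc c → weight (a + b) ≤ a * c + weight b
weight-+≤     zero    b 2≤c a+b≤c+1 = ≤-refl
weight-+≤ {c} (suc a) b 2≤c a+b≤c+1 = begin
  weight (suc (a + b))       ≤⟨ weight-suc≤ (a + b) 2≤c (≤-pred a+b≤c+1) ⟩
  c + weight (a + b)         ≤⟨ +-monoʳ-≤ c (weight-+≤ a b 2≤c (m≤n⇒m≤1+n (≤-pred a+b≤c+1))) ⟩
  c + (a * c + weight b)     ≡⟨ +-assoc c (a * c) (weight b) ⟨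
  suc a * c + weight b       ∎
  where open ≤-Reasoning

-- False for k = 2 (take a = b = 1); this is why clique number 2 is handled by a maximum matching.
weight-split : ∀ a b k → k ≢ 2 → a + b ≤ k → weight (a + b) ≤ (k ∸ 1) * a + weight b
weight-split a b 0                   k≢2 a+b≤k = ≤-trans (≤-reflexive (weight≤1≡0 (≤-trans a+b≤k z≤n))) z≤n
weight-split a b 1                   k≢2 a+b≤k = ≤-trans (≤-reflexive (weight≤1≡0 a+b≤k)) z≤n
weight-split a b 2                   k≢2 a+b≤k = ⊥-elim (k≢2 refl)
weight-split a b k@(suc (suc (suc j))) k≢2 a+b≤k = begin
  weight (a + b)                 ≤⟨ weight-+≤ a b (s≤s (s≤s z≤n)) a+b≤k ⟩
  a * (k ∸ 1) + weight b         ≡⟨ cong (_+ weight b) (*-comm a (k ∸ 1)) ⟩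
  (k ∸ 1) * a + weight b         ∎
  where open ≤-Reasoning

weight≤2*C2 : ∀ r → weight r ≤ 2 * (r C 2)
weight≤2*C2 0             = z≤n
weight≤2*C2 1             = z≤n
weight≤2*C2 (suc (suc m)) = begin
  suc c          ≤⟨ +-monoˡ-≤ c 1≤c ⟩
  c + c          ≡⟨ cong (c +_) (+-identityʳ c) ⟨
  2 * c          ∎
  where
  open ≤-Reasoning
  c = suc (suc m) C 2
  1≤c : 1 ≤ c
  1≤c = C2-mono {2} {suc (suc m)} (s≤s (s≤s z≤n))

[w+1]*C2≤w*weight : ∀ w r → r C 2 ≤ w → (w + 1) * (r C 2) ≤ w * weight r
[w+1]*C2≤w*weight w 0             _   = ≤-trans (≤-reflexive (*-zeroʳ (w + 1))) z≤n
[w+1]*C2≤w*weight w 1             _   = ≤-trans (≤-reflexive (*-zeroʳ (w + 1))) z≤n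
[w+1]*C2≤w*weight w (suc (suc m)) c≤w = begin
  (w + 1) * c    ≡⟨ *-distribʳ-+ c w 1 ⟩
  w * c + 1 * c  ≡⟨ cong (w * c +_) (*-identityˡ c) ⟩
  w * c + c      ≤⟨ +-monoʳ-≤ (w * c) c≤w ⟩
  w * c + w      ≡⟨ +-comm (w * c) w ⟩
  w + w * c      ≡⟨ *-suc w c ⟨
  w * suc c      ∎
  where
  open ≤-Reasoning
  c = suc (suc m) C 2

∣p∣≡∑𝟙∈ : ∀ {n} (p : Subset n) → ∣ p ∣ ≡ ∑[ v ← allFin n ] 𝟙 (v ∈? p)
∣p∣≡∑𝟙∈ []                = refl
∣p∣≡∑𝟙∈ {suc n} (s ∷ p) = begin
  ∣ s ∷ p ∣                                            ≡⟨ head s ⟩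
  𝟙 (zero ∈? s ∷ p) + ∣ p ∣                            ≡⟨ cong (𝟙 (zero ∈? s ∷ p) +_) (∣p∣≡∑𝟙∈ p) ⟩
  𝟙 (zero ∈? s ∷ p) + ∑[ v ← allFin n ] 𝟙 (v ∈? p)     ≡⟨ cong (𝟙 (zero ∈? s ∷ p) +_) (∑-cong (allFin n) ∈?-suc) ⟨
  𝟙 (zero ∈? s ∷ p) + ∑[ v ← allFin n ] 𝟙 (suc v ∈? s ∷ p) ≡⟨ ∑-allFin-suc n (λ v → 𝟙 (v ∈? s ∷ p)) ⟨
  ∑[ v ← allFin (suc n) ] 𝟙 (v ∈? s ∷ p)               ∎
  where
  open ≡-Reasoning
  head : ∀ s → ∣ s ∷ p ∣ ≡ 𝟙 (zero ∈? s ∷ p) + ∣ p ∣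
  head inside  = refl
  head outside = refl
  ∈?-suc : ∀ v → 𝟙 (suc v ∈? s ∷ p) ≡ 𝟙 (v ∈? p)
  ∈?-suc v = 𝟙-cong (suc v ∈? s ∷ p) (v ∈? p) drop-there there

∣p∩q∣≡∣p∩r∣+∣p∩[q─r]∣ : ∀ {n} (p q r : Subset n) → r ⊆ q → ∣ p ∩ q ∣ ≡ ∣ p ∩ r ∣ + ∣ p ∩ (q ─ r) ∣
∣p∩q∣≡∣p∩r∣+∣p∩[q─r]∣ []            []            []            r⊆q = refl
∣p∩q∣≡∣p∩r∣+∣p∩[q─r]∣ (outside ∷ p) (t       ∷ q) (u       ∷ r) r⊆q =
  ∣p∩q∣≡∣p∩r∣+∣p∩[q─r]∣ p q r (drop-∷-⊆ r⊆q)
∣p∩q∣≡∣p∩r∣+∣p∩[q─r]∣ (inside  ∷ p) (outside ∷ q) (outside ∷ r) r⊆q =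
  ∣p∩q∣≡∣p∩r∣+∣p∩[q─r]∣ p q r (drop-∷-⊆ r⊆q)
∣p∩q∣≡∣p∩r∣+∣p∩[q─r]∣ (inside  ∷ p) (outside ∷ q) (inside  ∷ r) r⊆q with r⊆q here
... | ()
∣p∩q∣≡∣p∩r∣+∣p∩[q─r]∣ (inside  ∷ p) (inside  ∷ q) (outside ∷ r) r⊆q =
  ≡.trans (cong suc (∣p∩q∣≡∣p∩r∣+∣p∩[q─r]∣ p q r (drop-∷-⊆ r⊆q))) (≡.sym (+-suc _ _))
∣p∩q∣≡∣p∩r∣+∣p∩[q─r]∣ (inside  ∷ p) (inside  ∷ q) (inside  ∷ r) r⊆q =
  cong suc (∣p∩q∣≡∣p∩r∣+∣p∩[q─r]∣ p q r (drop-∷-⊆ r⊆q))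

2≤∣p∣ : ∀ {n} {p : Subset n} {x y} → x ∈ p → y ∈ p → x ≢ y → 2 ≤ ∣ p ∣
2≤∣p∣ {p = p} {x} {y} x∈p y∈p x≢y = begin
  2                  ≤⟨ s≤s (≤-trans (s≤s z≤n) (x∈p⇒∣p-x∣<∣p∣ y∈p-x)) ⟩
  1 + ∣ p - x ∣      ≤⟨ x∈p⇒∣p-x∣<∣p∣ x∈p ⟩
  ∣ p ∣              ∎
  where
  open ≤-Reasoning
  y∈p-x : y ∈ p - x
  y∈p-x = x∈p∧x≢y⇒x∈p-y y∈p (≢-sym x≢y)

3≤∣p∣ : ∀ {n} {p : Subset n} {x y z} → x ∈ p → y ∈ p → z ∈ p → x ≢ y → x ≢ z → y ≢ z → 3 ≤ ∣ p ∣
3≤∣p∣ {p = p} {x} {y} {z} x∈p y∈p z∈p x≢y x≢z y≢z = begin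
  3                  ≤⟨ s≤s (2≤∣p∣ (x∈p∧x≢y⇒x∈p-y y∈p (≢-sym x≢y)) (x∈p∧x≢y⇒x∈p-y z∈p (≢-sym x≢z)) y≢z) ⟩
  1 + ∣ p - x ∣      ≤⟨ x∈p⇒∣p-x∣<∣p∣ x∈p ⟩
  ∣ p ∣              ∎
  where open ≤-Reasoning

pairIn? : ∀ {n} (p : Subset n) (u v : Fin n) → Dec (toℕ u < toℕ v × u ∈ p × v ∈ p)
pairIn? p u v = toℕ u <? toℕ v ×-dec (u ∈? p ×-dec v ∈? p)

pairs : ∀ {n} → Subset n → ℕ
pairs {n} p = ∑[ u ← allFin n ] ∑[ v ← allFin n ] 𝟙 (pairIn? p u v)

pairs≡∣p∣C2 : ∀ {n} (p : Subset n) → pairs p ≡ ∣ p ∣ C 2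
pairs≡∣p∣C2 []              = refl
pairs≡∣p∣C2 {suc n} (s ∷ p) = begin
  pairs (s ∷ p)
    ≡⟨ ∑-allFin-suc n (λ u → ∑[ v ← allFin (suc n) ] 𝟙 (pairIn? (s ∷ p) u v)) ⟩
  ∑[ v ← allFin (suc n) ] 𝟙 (pairIn? (s ∷ p) zero v) + ∑[ u ← F ] ∑[ v ← allFin (suc n) ] 𝟙 (pairIn? (s ∷ p) (suc u) v)
    ≡⟨ cong₂ _+_ (∑-allFin-suc n (𝟙 ∘ pairIn? (s ∷ p) zero))
                 (∑-cong F (λ u → ≡.trans (∑-allFin-suc n (𝟙 ∘ pairIn? (s ∷ p) (suc u))) (∑-cong F (pairIn?-suc u)))) ⟩
  ∑[ v ← F ] 𝟙 (pairIn? (s ∷ p) zero (suc v)) + pairs p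
    ≡⟨ cong (∑[ v ← F ] 𝟙 (pairIn? (s ∷ p) zero (suc v)) +_) (pairs≡∣p∣C2 p) ⟩
  ∑[ v ← F ] 𝟙 (pairIn? (s ∷ p) zero (suc v)) + ∣ p ∣ C 2
    ≡⟨ pairs-with-zero s ⟩
  ∣ s ∷ p ∣ C 2 ∎
  where
  open ≡-Reasoning
  F : List (Fin n)
  F = allFin n
  pairIn?-suc : ∀ u v → 𝟙 (pairIn? (s ∷ p) (suc u) (suc v)) ≡ 𝟙 (pairIn? p u v)
  pairIn?-suc u v = 𝟙-cong (pairIn? (s ∷ p) (suc u) (suc v)) (pairIn? p u v)
    (λ { (s≤s u<v , there u∈p , there v∈p) → u<v , u∈p , v∈p })
    (λ { (u<v , u∈p , v∈p) → s≤s u<v , there u∈p , there v∈p })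
  pairs-with-zero : ∀ s → ∑[ v ← F ] 𝟙 (pairIn? (s ∷ p) zero (suc v)) + ∣ p ∣ C 2 ≡ ∣ s ∷ p ∣ C 2
  pairs-with-zero inside = begin
    ∑[ v ← F ] 𝟙 (pairIn? (inside ∷ p) zero (suc v)) + ∣ p ∣ C 2
      ≡⟨ cong (_+ ∣ p ∣ C 2) (∑-cong F (λ v → 𝟙-cong (pairIn? (inside ∷ p) zero (suc v)) (v ∈? p)
           (λ { (_ , _ , there v∈p) → v∈p }) (λ v∈p → s≤s z≤n , here , there v∈p))) ⟩
    ∑[ v ← F ] 𝟙 (v ∈? p) + ∣ p ∣ C 2 ≡⟨ cong (_+ ∣ p ∣ C 2) (∣p∣≡∑𝟙∈ p) ⟨
    ∣ p ∣ + ∣ p ∣ C 2                 ≡⟨ suc-C2 ∣ p ∣ ⟨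
    suc ∣ p ∣ C 2                     ∎
  pairs-with-zero outside = cong (_+ ∣ p ∣ C 2)
    (≡.trans (∑-cong F (λ v → 𝟙-no (pairIn? (outside ∷ p) zero (suc v)) (λ { (_ , () , _) }))) (∑-zero F))

x∈p─q⇒x∉q : ∀ {n} (p q : Subset n) {x} → x ∈ p ─ q → x ∉ q
x∈p─q⇒x∉q (inside ∷ p) (outside ∷ q) here = λ ()
x∈p─q⇒x∉q (s ∷ p) (t ∷ q) (there x∈p─q) (there x∈q) = x∈p─q⇒x∉q p q x∈p─q x∈q

∈edge⁻ : ∀ {n} {a b x : Fin n} → x ∈ ⁅ a ⁆ ∪ ⁅ b ⁆ → x ≡ a ⊎ x ≡ b
∈edge⁻ {a = a} {b} x∈ with x∈p∪q⁻ ⁅ a ⁆ ⁅ b ⁆ x∈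
... | inj₁ x∈a = inj₁ (x∈⁅y⁆⇒x≡y a x∈a)
... | inj₂ x∈b = inj₂ (x∈⁅y⁆⇒x≡y b x∈b)

vertexPairs : ∀ n → List (Fin n × Fin n)
vertexPairs n = cartesianProduct (allFin n) (allFin n)

pairs≡∑vertexPairs : ∀ {n} (p : Subset n) → pairs p ≡ ∑[ e ← vertexPairs n ] 𝟙 (pairIn? p (proj₁ e) (proj₂ e))
pairs≡∑vertexPairs {n} p = ≡.sym (∑-cartesianProduct (allFin n) (allFin n) (λ e → 𝟙 (pairIn? p (proj₁ e) (proj₂ e))))

All-⊆-trans : ∀ {n} {T T′ : Subset n} {𝒳 : List (Subset n)} → T ⊆ T′ → All (_⊆ T) 𝒳 → All (_⊆ T′) 𝒳
All-⊆-trans T⊆T′ []             = []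
All-⊆-trans T⊆T′ (Y⊆T ∷ 𝒳⊆T) = (T⊆T′ ∘ Y⊆T) ∷ All-⊆-trans T⊆T′ 𝒳⊆T

∈-⋃ : ∀ {n} {T : Subset n} {u} {𝒳 : List (Subset n)} → All (_⊆ T) 𝒳 → Any (u ∈_) 𝒳 → u ∈ T
∈-⋃ 𝒳⊆T u∈𝒳 = All.lookupWith (λ Y⊆T u∈Y → Y⊆T u∈Y) 𝒳⊆T u∈𝒳

EndsDisjoint : ∀ {n} → Fin n × Fin n → Fin n × Fin n → Set
EndsDisjoint (u , v) (u′ , v′) = u ≢ u′ × u ≢ v′ × v ≢ u′ × v ≢ v′

AllPairs-under : ∀ {P : A → Set p} {R : A → A → Set r} {xs} → All P xs →
                 AllPairs (λ x y → P x → P y → R x y) xs → AllPairs R xs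
AllPairs-under []         []         = []
AllPairs-under (px ∷ pxs) (rx ∷ rxs) = All.zipWith (λ (py , r) → r px py) (pxs , rx) ∷ AllPairs-under pxs rxs

module _ {n : ℕ} (G : Graph n) where

  IsClique-∩ : ∀ {Q} S → IsClique G Q → IsClique G (Q ∩ S)
  IsClique-∩ {Q} S Q-clique u v u∈ v∈ u≢v = Q-clique u v (proj₁ (x∈p∩q⁻ Q S u∈)) (proj₁ (x∈p∩q⁻ Q S v∈)) u≢v

  ∣Q∩S∣≤ω : ∀ {S Q k} → IsCliqueNumberOf G S k → IsClique G Q → ∣ Q ∩ S ∣ ≤ k
  ∣Q∩S∣≤ω {S} {Q} (_ , maximum) Q-clique = maximum (Q ∩ S) (p∩q⊆q Q S) (IsClique-∩ S Q-clique)

  numEdges≡∑𝟙 : ∀ 𝒳 → numEdges G 𝒳 ≡ ∑ (vertexPairs n) (𝟙 ∘ sameEdge? G 𝒳)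
  numEdges≡∑𝟙 𝒳 = length-filter≡∑𝟙 (sameEdge? G 𝒳) (vertexPairs n)

  numEdges-mono : ∀ 𝒳 𝒳′ → (∀ {u v} → Any (λ X → u ∈ X × v ∈ X) 𝒳 → Any (λ X → u ∈ X × v ∈ X) 𝒳′) →
                  numEdges G 𝒳 ≤ numEdges G 𝒳′
  numEdges-mono 𝒳 𝒳′ 𝒳⇒𝒳′ = begin
    numEdges G 𝒳                               ≡⟨ numEdges≡∑𝟙 𝒳 ⟩
    ∑ (vertexPairs n) (𝟙 ∘ sameEdge? G 𝒳)      ≤⟨ ∑-mono (vertexPairs n) (λ e → 𝟙-mono (sameEdge? G 𝒳 e) (sameEdge? G 𝒳′ e)
                                                    (λ (u<v , uv , same) → u<v , uv , 𝒳⇒𝒳′ same)) ⟩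
    ∑ (vertexPairs n) (𝟙 ∘ sameEdge? G 𝒳′)     ≡⟨ numEdges≡∑𝟙 𝒳′ ⟨
    numEdges G 𝒳′                              ∎
    where open ≤-Reasoning

  numEdges-∷ : ∀ {X} 𝒳 → IsClique G X → (∀ {u} → u ∈ X → ¬ Any (u ∈_) 𝒳) →
               ∣ X ∣ C 2 + numEdges G 𝒳 ≤ numEdges G (X ∷ 𝒳)
  numEdges-∷ {X} 𝒳 X-clique X-fresh = begin
    ∣ X ∣ C 2 + numEdges G 𝒳
      ≡⟨ cong₂ _+_ (≡.trans (≡.sym (pairs≡∣p∣C2 X)) (pairs≡∑vertexPairs X)) (numEdges≡∑𝟙 𝒳) ⟩
    ∑[ e ← vertexPairs n ] 𝟙 (pairIn? X (proj₁ e) (proj₂ e)) + ∑ (vertexPairs n) (𝟙 ∘ sameEdge? G 𝒳)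
      ≡⟨ ∑-distrib-+ (vertexPairs n) _ _ ⟨
    ∑[ e ← vertexPairs n ] (𝟙 (pairIn? X (proj₁ e) (proj₂ e)) + 𝟙 (sameEdge? G 𝒳 e))
      ≤⟨ ∑-mono (vertexPairs n) new-or-old ⟩
    ∑ (vertexPairs n) (𝟙 ∘ sameEdge? G (X ∷ 𝒳))
      ≡⟨ numEdges≡∑𝟙 (X ∷ 𝒳) ⟨
    numEdges G (X ∷ 𝒳) ∎
    where
    open ≤-Reasoning
    new-or-old : ∀ e → 𝟙 (pairIn? X (proj₁ e) (proj₂ e)) + 𝟙 (sameEdge? G 𝒳 e) ≤ 𝟙 (sameEdge? G (X ∷ 𝒳) e)
    new-or-old (u , v) = 𝟙-disjoint (pairIn? X u v) (sameEdge? G 𝒳 (u , v)) (sameEdge? G (X ∷ 𝒳) (u , v))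
      (λ ((_ , u∈X , _) , (_ , _ , same)) → X-fresh u∈X (Any.map proj₁ same))
      (λ (u<v , u∈X , v∈X) → u<v , X-clique u v u∈X v∈X (Fin.<⇒≢ u<v) , here (u∈X , v∈X))
      (λ (u<v , uv , same) → u<v , uv , there same)

  edge-isClique : ∀ {a b} → Adj G a b → IsClique G (⁅ a ⁆ ∪ ⁅ b ⁆)
  edge-isClique {a} {b} ab u v u∈ v∈ u≢v with ∈edge⁻ u∈ | ∈edge⁻ v∈
  ... | inj₁ refl | inj₁ refl = ⊥-elim (u≢v refl)
  ... | inj₁ refl | inj₂ refl = ab
  ... | inj₂ refl | inj₁ refl = Graph.sym G ab
  ... | inj₂ refl | inj₂ refl = ⊥-elim (u≢v refl)

  ∈edgeParts⇒∈endpoints : ∀ {x} M → Any (x ∈_) (edgeParts G M) → x List.∈ endpoints G M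
  ∈edgeParts⇒∈endpoints (_ ∷ M) (here x∈) with ∈edge⁻ x∈
  ... | inj₁ x≡a = here x≡a
  ... | inj₂ x≡b = there (here x≡b)
  ∈edgeParts⇒∈endpoints (_ ∷ M) (there x∈) = there (there (∈edgeParts⇒∈endpoints M x∈))

  length≤numEdges-edgeParts : ∀ M → All (λ e → Adj G (proj₁ e) (proj₂ e)) M → Unique (endpoints G M) →
                              length M ≤ numEdges G (edgeParts G M)
  length≤numEdges-edgeParts []             _         _ = z≤n
  length≤numEdges-edgeParts ((a , b) ∷ M) (ab ∷ adj) ((a≢b ∷ a∉M) ∷ (b∉M ∷ unique)) = begin
    suc (length M)                        ≤⟨ s≤s (length≤numEdges-edgeParts M adj unique) ⟩
    1 + numEdges G (edgeParts G M)        ≤⟨ +-monoˡ-≤ _ (C2-mono {2} {∣ ⁅ a ⁆ ∪ ⁅ b ⁆ ∣} (2≤∣p∣ a∈ b∈ a≢b)) ⟩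
    ∣ ⁅ a ⁆ ∪ ⁅ b ⁆ ∣ C 2 + numEdges G (edgeParts G M)
      ≤⟨ numEdges-∷ (edgeParts G M) (edge-isClique ab) fresh ⟩
    numEdges G (edgeParts G ((a , b) ∷ M)) ∎
    where
    open ≤-Reasoning
    a∈ : a ∈ ⁅ a ⁆ ∪ ⁅ b ⁆
    a∈ = x∈p∪q⁺ (inj₁ (x∈⁅x⁆ a))
    b∈ : b ∈ ⁅ a ⁆ ∪ ⁅ b ⁆
    b∈ = x∈p∪q⁺ (inj₂ (x∈⁅x⁆ b))
    fresh : ∀ {u} → u ∈ ⁅ a ⁆ ∪ ⁅ b ⁆ → ¬ Any (u ∈_) (edgeParts G M)
    fresh u∈ u∈M with ∈edge⁻ u∈
    ... | inj₁ refl = All¬⇒¬Any a∉M (∈edgeParts⇒∈endpoints M u∈M)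
    ... | inj₂ refl = All¬⇒¬Any b∉M (∈edgeParts⇒∈endpoints M u∈M)

  numEdges-++ : ∀ 𝒳 𝒳′ → numEdges G 𝒳 ≤ numEdges G (𝒳 ++ 𝒳′)
  numEdges-++ 𝒳 𝒳′ = numEdges-mono 𝒳 (𝒳 ++ 𝒳′) ++⁺ˡ

  edgeParts⊆ : ∀ {S M} → IsMatchingIn G S M → All (_⊆ S) (edgeParts G M)
  edgeParts⊆ {S} (edges , _) = go edges
    where
    go : ∀ {M} → All (λ e → Adj G (proj₁ e) (proj₂ e) × proj₁ e ∈ S × proj₂ e ∈ S) M → All (_⊆ S) (edgeParts G M)
    go []                       = []
    go ((_ , a∈S , b∈S) ∷ rest) = (λ x∈ → [ (λ { refl → a∈S }) , (λ { refl → b∈S }) ] (∈edge⁻ x∈)) ∷ go rest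

  GreedyEdmonds⇒⊆ : ∀ {S 𝒳} → GreedyEdmonds G S 𝒳 → All (_⊆ S) 𝒳
  GreedyEdmonds⇒⊆ (done _) = []
  GreedyEdmonds⇒⊆ {S} (matching {M = M} _ _ (M-matching , _) run) =
    ++⁺ (edgeParts⊆ M-matching) (All-⊆-trans (p─q⊆p S (vertexSet G M)) (GreedyEdmonds⇒⊆ run))
  GreedyEdmonds⇒⊆ {S} (clique {X = X} _ _ (X⊆S , _) run) =
    X⊆S ∷ All-⊆-trans (p─q⊆p S X) (GreedyEdmonds⇒⊆ run)

  Unique-endpoints : ∀ {M} → AllPairs EndsDisjoint M → All (λ e → proj₁ e ≢ proj₂ e) M → Unique (endpoints G M)
  Unique-endpoints []                   []             = []
  Unique-endpoints (disjoint ∷ disjoints) (u≢v ∷ proper) =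
    (u≢v ∷ endpoints⁺ (All.map (λ (u≢u′ , u≢v′ , _) → u≢u′ , u≢v′) disjoint))
    ∷ endpoints⁺ (All.map (λ (_ , _ , v≢u′ , v≢v′) → v≢u′ , v≢v′) disjoint)
    ∷ Unique-endpoints disjoints proper
    where
    endpoints⁺ : ∀ {P : Fin n → Set} {M} → All (λ e → P (proj₁ e) × P (proj₂ e)) M → All P (endpoints G M)
    endpoints⁺ []                = []
    endpoints⁺ ((pu , pv) ∷ pes) = pu ∷ pv ∷ endpoints⁺ pes

  module _ {𝒴 : List (Subset n)} (𝒴-partition : IsCliquePartition G 𝒴) where

    ∑𝟙∈≡1 : ∀ v → ∑[ Q ← 𝒴 ] 𝟙 (v ∈? Q) ≡ 1
    ∑𝟙∈≡1 v = ≡.trans (≡.sym (length-filter≡∑𝟙 (v ∈?_) 𝒴)) (proj₂ 𝒴-partition v)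

    parts-clique : All (IsClique G) 𝒴
    parts-clique = All.map proj₁ (proj₁ 𝒴-partition)

    ∑∣Q∩X∣≡∣X∣ : ∀ X → ∑[ Q ← 𝒴 ] ∣ Q ∩ X ∣ ≡ ∣ X ∣
    ∑∣Q∩X∣≡∣X∣ X = begin
      ∑[ Q ← 𝒴 ] ∣ Q ∩ X ∣                            ≡⟨ ∑-cong 𝒴 (λ Q → ∣p∣≡∑𝟙∈ (Q ∩ X)) ⟩
      ∑[ Q ← 𝒴 ] ∑[ v ← allFin n ] 𝟙 (v ∈? Q ∩ X)    ≡⟨ ∑-comm 𝒴 (allFin n) _ ⟩
      ∑[ v ← allFin n ] ∑[ Q ← 𝒴 ] 𝟙 (v ∈? Q ∩ X)    ≡⟨ ∑-cong (allFin n) count-v ⟩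
      ∑[ v ← allFin n ] 𝟙 (v ∈? X)                    ≡⟨ ∣p∣≡∑𝟙∈ X ⟨
      ∣ X ∣                                           ∎
      where
      open ≡-Reasoning
      count-v : ∀ v → ∑[ Q ← 𝒴 ] 𝟙 (v ∈? Q ∩ X) ≡ 𝟙 (v ∈? X)
      count-v v with v ∈? X
      ... | yes v∈X = ≡.trans (∑-cong 𝒴 (λ Q → 𝟙-cong (v ∈? Q ∩ X) (v ∈? Q)
                                        (proj₁ ∘ x∈p∩q⁻ Q X) (λ v∈Q → x∈p∩q⁺ (v∈Q , v∈X))))
                              (∑𝟙∈≡1 v)
      ... | no v∉X  = ≡.trans (∑-cong 𝒴 (λ Q → 𝟙-no (v ∈? Q ∩ X) (v∉X ∘ proj₂ ∘ x∈p∩q⁻ Q X))) (∑-zero 𝒴)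

    potential : Subset n → ℕ
    potential S = ∑[ Q ← 𝒴 ] weight ∣ Q ∩ S ∣

    potential-empty : ∀ {S} → Empty S → potential S ≡ 0
    potential-empty S-empty rewrite Empty-unique S-empty =
      ≡.trans (∑-cong 𝒴 (λ Q → cong weight (≡.trans (cong ∣_∣ (∩-zeroʳ Q)) (∣⊥∣≡0 n)))) (∑-zero 𝒴)

    potential-clique : ∀ {S X} → ¬ IsCliqueNumberOf G S 2 → IsMaxCliqueIn G S X →
                       potential S ≤ 2 * (∣ X ∣ C 2) + potential (S ─ X)
    potential-clique {S} {X} ω≢2 (X⊆S , _ , ω≡k) = begin
      potential S                                        ≤⟨ ∑-mono-All parts-clique split ⟩
      ∑[ Q ← 𝒴 ] ((k ∸ 1) * ∣ Q ∩ X ∣ + weight ∣ Q ∩ (S ─ X) ∣)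
        ≡⟨ ∑-distrib-+ 𝒴 _ _ ⟩
      ∑[ Q ← 𝒴 ] ((k ∸ 1) * ∣ Q ∩ X ∣) + potential (S ─ X)
        ≡⟨ cong (_+ potential (S ─ X)) (≡.trans (∑-distribˡ-* 𝒴 (k ∸ 1) _) (cong ((k ∸ 1) *_) (∑∣Q∩X∣≡∣X∣ X))) ⟩
      (k ∸ 1) * k + potential (S ─ X)                    ≡⟨ cong (_+ potential (S ─ X)) (≡.trans (*-comm (k ∸ 1) k) (≡.sym (2*C2≡*pred k))) ⟩
      2 * (k C 2) + potential (S ─ X)                    ∎
      where
      open ≤-Reasoning
      k : ℕ
      k = ∣ X ∣
      k≢2 : k ≢ 2
      k≢2 k≡2 = ω≢2 (subst (IsCliqueNumberOf G S) k≡2 ω≡k)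
      split : ∀ {Q} → IsClique G Q → weight ∣ Q ∩ S ∣ ≤ (k ∸ 1) * ∣ Q ∩ X ∣ + weight ∣ Q ∩ (S ─ X) ∣
      split {Q} Q-clique rewrite ∣p∩q∣≡∣p∩r∣+∣p∩[q─r]∣ Q S X X⊆S = weight-split _ _ k k≢2 ∣Q∩S∣≤k
        where
        ∣Q∩S∣≤k : ∣ Q ∩ X ∣ + ∣ Q ∩ (S ─ X) ∣ ≤ k
        ∣Q∩S∣≤k = subst (_≤ k) (∣p∩q∣≡∣p∩r∣+∣p∩[q─r]∣ Q S X X⊆S) (∣Q∩S∣≤ω ω≡k Q-clique)

    PartEdge : Subset n → Fin n × Fin n → Set
    PartEdge S (u , v) = (toℕ u < toℕ v × u ∈ S × v ∈ S) × Any (λ Q → u ∈ Q × v ∈ Q) 𝒴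

    partEdge? : ∀ S → U.Decidable (PartEdge S)
    partEdge? S (u , v) = pairIn? S u v ×-dec any? (λ Q → u ∈? Q ×-dec v ∈? Q) 𝒴

    partEdges : Subset n → List (Fin n × Fin n)
    partEdges S = filter (partEdge? S) (vertexPairs n)

    ∑C2≡length-partEdges : ∀ S → ∑[ Q ← 𝒴 ] (∣ Q ∩ S ∣ C 2) ≡ length (partEdges S)
    ∑C2≡length-partEdges S = begin
      ∑[ Q ← 𝒴 ] (∣ Q ∩ S ∣ C 2)
        ≡⟨ ∑-cong 𝒴 (λ Q → ≡.trans (≡.sym (pairs≡∣p∣C2 (Q ∩ S))) (pairs≡∑vertexPairs (Q ∩ S))) ⟩
      ∑[ Q ← 𝒴 ] ∑[ e ← vertexPairs n ] 𝟙 (pairIn? (Q ∩ S) (proj₁ e) (proj₂ e))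
        ≡⟨ ∑-comm 𝒴 (vertexPairs n) _ ⟩
      ∑[ e ← vertexPairs n ] ∑[ Q ← 𝒴 ] 𝟙 (pairIn? (Q ∩ S) (proj₁ e) (proj₂ e))
        ≡⟨ ∑-cong (vertexPairs n) count-e ⟩
      ∑[ e ← vertexPairs n ] 𝟙 (partEdge? S e)
        ≡⟨ length-filter≡∑𝟙 (partEdge? S) (vertexPairs n) ⟨
      length (partEdges S) ∎
      where
      open ≡-Reasoning
      count-e : ∀ e → ∑[ Q ← 𝒴 ] 𝟙 (pairIn? (Q ∩ S) (proj₁ e) (proj₂ e)) ≡ 𝟙 (partEdge? S e)
      count-e (u , v) with pairIn? S u v
      ... | no ¬pair = ≡.trans
        (∑-cong 𝒴 (λ Q → 𝟙-no (pairIn? (Q ∩ S) u v)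
          (λ (u<v , u∈ , v∈) → ¬pair (u<v , proj₂ (x∈p∩q⁻ Q S u∈) , proj₂ (x∈p∩q⁻ Q S v∈)))))
        (∑-zero 𝒴)
      ... | yes pair@(u<v , u∈S , v∈S) = begin
        ∑[ Q ← 𝒴 ] 𝟙 (pairIn? (Q ∩ S) u v)   ≡⟨ ∑-cong 𝒴 (λ Q → 𝟙-cong (pairIn? (Q ∩ S) u v) (both? Q)
                                                  (λ (_ , u∈ , v∈) → proj₁ (x∈p∩q⁻ Q S u∈) , proj₁ (x∈p∩q⁻ Q S v∈))
                                                  (λ (u∈Q , v∈Q) → u<v , x∈p∩q⁺ (u∈Q , u∈S) , x∈p∩q⁺ (v∈Q , v∈S))) ⟩
        ∑[ Q ← 𝒴 ] 𝟙 (both? Q)               ≡⟨ ≤-antisym (∑𝟙≤𝟙-Any both? (any? both? 𝒴) ∑≤1) (𝟙-Any≤∑𝟙 both? (any? both? 𝒴)) ⟩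
        𝟙 (any? both? 𝒴)                     ≡⟨ 𝟙-cong (any? both? 𝒴) (yes pair ×-dec any? both? 𝒴) (pair ,_) proj₂ ⟩
        𝟙 (yes pair ×-dec any? both? 𝒴)      ∎
        where
        both? : ∀ Q → Dec (u ∈ Q × v ∈ Q)
        both? Q = u ∈? Q ×-dec v ∈? Q
        ∑≤1 : ∑[ Q ← 𝒴 ] 𝟙 (both? Q) ≤ 1
        ∑≤1 = ≤-trans (∑-mono 𝒴 (λ Q → 𝟙-mono (both? Q) (u ∈? Q) proj₁)) (≤-reflexive (∑𝟙∈≡1 u))

    module _ {S : Subset n} (ω≡2 : IsCliqueNumberOf G S 2) where

      same-part-partner : ∀ {x y z} → x ∈ S → y ∈ S → z ∈ S → x ≢ y → x ≢ z →
                          Any (λ Q → x ∈ Q × y ∈ Q) 𝒴 → Any (λ Q → x ∈ Q × z ∈ Q) 𝒴 → y ≡ z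
      same-part-partner {x} {y} {z} x∈S y∈S z∈S x≢y x≢z xy xz with y ≟ z
      ... | yes y≡z = y≡z
      ... | no y≢z  = ⊥-elim (1+n≰n (three-in-part (All.lookupAny parts-clique shared)))
        where
        shared : Any (λ Q → (x ∈ Q × y ∈ Q) × (x ∈ Q × z ∈ Q)) 𝒴
        shared = ∑𝟙≤1⇒Any-× (x ∈?_) (≤-reflexive (∑𝟙∈≡1 x)) proj₁ proj₁ xy xz
        three-in-part : ∀ {Q} → IsClique G Q × (x ∈ Q × y ∈ Q) × (x ∈ Q × z ∈ Q) → 3 ≤ 2
        three-in-part {Q} (Q-clique , (x∈Q , y∈Q) , (_ , z∈Q)) = begin
          3              ≤⟨ 3≤∣p∣ (x∈p∩q⁺ (x∈Q , x∈S)) (x∈p∩q⁺ (y∈Q , y∈S)) (x∈p∩q⁺ (z∈Q , z∈S)) x≢y x≢z y≢z ⟩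
          ∣ Q ∩ S ∣      ≤⟨ ∣Q∩S∣≤ω ω≡2 Q-clique ⟩
          2              ∎
          where open ≤-Reasoning

      partEdges-EndsDisjoint : ∀ {e e′} → e ≢ e′ → PartEdge S e → PartEdge S e′ → EndsDisjoint e e′
      partEdges-EndsDisjoint {u , v} {u′ , v′} e≢e′ ((u<v , u∈S , v∈S) , uv) ((u′<v′ , u′∈S , v′∈S) , u′v′) =
        u≢u′ , u≢v′ , v≢u′ , v≢v′
        where
        flip : ∀ {x y} → Any (λ Q → x ∈ Q × y ∈ Q) 𝒴 → Any (λ Q → y ∈ Q × x ∈ Q) 𝒴
        flip = Any.map (λ (x∈ , y∈) → y∈ , x∈)
        u≢v : u ≢ v
        u≢v = Fin.<⇒≢ u<v
        u′≢v′ : u′ ≢ v′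
        u′≢v′ = Fin.<⇒≢ u′<v′
        u≢u′ : u ≢ u′
        u≢u′ refl = e≢e′ (cong (u ,_) (same-part-partner u∈S v∈S v′∈S u≢v u′≢v′ uv u′v′))
        u≢v′ : u ≢ v′
        u≢v′ refl with same-part-partner u∈S v∈S u′∈S u≢v (≢-sym u′≢v′) uv (flip u′v′)
        ... | refl = <-asym u<v u′<v′
        v≢u′ : v ≢ u′
        v≢u′ refl with same-part-partner v∈S u∈S v′∈S (≢-sym u≢v) u′≢v′ (flip uv) u′v′
        ... | refl = <-asym u<v u′<v′
        v≢v′ : v ≢ v′
        v≢v′ refl = e≢e′ (cong (_, v) (same-part-partner v∈S u∈S u′∈S (≢-sym u≢v) (≢-sym u′≢v′) (flip uv) (flip u′v′)))

      partEdges-isMatching : IsMatchingIn G S (partEdges S)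
      partEdges-isMatching =
        All.map (λ ((u<v , u∈S , v∈S) , uv) → adjacent u<v uv , u∈S , v∈S) part-edges ,
        Unique-endpoints
          (AllPairs-under part-edges
            (AllPairs.map partEdges-EndsDisjoint
              (Unique-filter⁺ (partEdge? S) (cartesianProduct⁺ (allFin⁺ n) (allFin⁺ n)))))
          (All.map (λ ((u<v , _) , _) → Fin.<⇒≢ u<v) part-edges)
        where
        part-edges : All (PartEdge S) (partEdges S)
        part-edges = all-filter (partEdge? S) (vertexPairs n)
        adjacent : ∀ {u v} → toℕ u < toℕ v → Any (λ Q → u ∈ Q × v ∈ Q) 𝒴 → Adj G u v
        adjacent {u} {v} u<v uv = All.lookupWith (λ Q-clique (u∈Q , v∈Q) → Q-clique u v u∈Q v∈Q (Fin.<⇒≢ u<v)) parts-clique uv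

      potential-matching : ∀ {M} → IsMaxMatchingIn G S M → potential S ≤ 2 * length M
      potential-matching {M} (_ , M-maximum) = begin
        potential S                          ≤⟨ ∑-mono 𝒴 (λ Q → weight≤2*C2 ∣ Q ∩ S ∣) ⟩
        ∑[ Q ← 𝒴 ] (2 * (∣ Q ∩ S ∣ C 2))     ≡⟨ ∑-distribˡ-* 𝒴 2 _ ⟩
        2 * ∑[ Q ← 𝒴 ] (∣ Q ∩ S ∣ C 2)       ≡⟨ cong (2 *_) (∑C2≡length-partEdges S) ⟩
        2 * length (partEdges S)             ≤⟨ *-monoʳ-≤ 2 (M-maximum (partEdges S) partEdges-isMatching) ⟩
        2 * length M                         ∎
        where open ≤-Reasoning

    potential≤2*numEdges : ∀ {S 𝒳} → GreedyEdmonds G S 𝒳 → potential S ≤ 2 * numEdges G 𝒳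
    potential≤2*numEdges (done S-empty) = ≤-trans (≤-reflexive (potential-empty S-empty)) z≤n
    potential≤2*numEdges {S} (matching {M = M} {𝒳} _ ω≡2 M-maximum@((edges , unique) , _) _) = begin
      potential S                            ≤⟨ potential-matching ω≡2 M-maximum ⟩
      2 * length M                           ≤⟨ *-monoʳ-≤ 2 (length≤numEdges-edgeParts M (All.map proj₁ edges) unique) ⟩
      2 * numEdges G (edgeParts G M)         ≤⟨ *-monoʳ-≤ 2 (numEdges-++ (edgeParts G M) 𝒳) ⟩
      2 * numEdges G (edgeParts G M ++ 𝒳)    ∎
      where open ≤-Reasoning
    potential≤2*numEdges {S} (clique {X = X} {𝒳} _ ω≢2 X-maximum@(_ , X-clique , _) run) = begin
      potential S                            ≤⟨ potential-clique ω≢2 X-maximum ⟩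
      2 * (∣ X ∣ C 2) + potential (S ─ X)    ≤⟨ +-monoʳ-≤ (2 * (∣ X ∣ C 2)) (potential≤2*numEdges run) ⟩
      2 * (∣ X ∣ C 2) + 2 * numEdges G 𝒳     ≡⟨ *-distribˡ-+ 2 (∣ X ∣ C 2) (numEdges G 𝒳) ⟨
      2 * (∣ X ∣ C 2 + numEdges G 𝒳)         ≤⟨ *-monoʳ-≤ 2 (numEdges-∷ 𝒳 X-clique X-fresh) ⟩
      2 * numEdges G (X ∷ 𝒳)                 ∎
      where
      open ≤-Reasoning
      X-fresh : ∀ {u} → u ∈ X → ¬ Any (u ∈_) 𝒳
      X-fresh u∈X u∈𝒳 = x∈p─q⇒x∉q S X (∈-⋃ (GreedyEdmonds⇒⊆ run) u∈𝒳) u∈X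

    numEdges≤∑C2 : numEdges G 𝒴 ≤ ∑[ Q ← 𝒴 ] (∣ Q ∩ ⊤ ∣ C 2)
    numEdges≤∑C2 = begin
      numEdges G 𝒴                               ≡⟨ numEdges≡∑𝟙 𝒴 ⟩
      ∑ (vertexPairs n) (𝟙 ∘ sameEdge? G 𝒴)      ≤⟨ ∑-mono (vertexPairs n) (λ e → 𝟙-mono (sameEdge? G 𝒴 e) (partEdge? ⊤ e)
                                                      (λ (u<v , _ , uv) → (u<v , ∈⊤ , ∈⊤) , uv)) ⟩
      ∑ (vertexPairs n) (𝟙 ∘ partEdge? ⊤)        ≡⟨ length-filter≡∑𝟙 (partEdge? ⊤) (vertexPairs n) ⟨
      length (partEdges ⊤)                       ≡⟨ ∑C2≡length-partEdges ⊤ ⟨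
      ∑[ Q ← 𝒴 ] (∣ Q ∩ ⊤ ∣ C 2)                 ∎
      where open ≤-Reasoning

theorem2 : ∀ {n} (G : Graph n) (ω : ℕ) → IsCliqueNumberOf G ⊤ ω →
    ∀ (𝒳 : List (Subset n)) → GreedyEdmonds G ⊤ 𝒳 →
    ∀ (𝒴 : List (Subset n)) → IsCliquePartition G 𝒴 →
    (ω C 2 + 1) * numEdges G 𝒴 ≤ 2 * (ω C 2) * numEdges G 𝒳
theorem2 G ω ω-cliqueNumber 𝒳 greedy 𝒴 𝒴-partition = begin
  (w + 1) * numEdges G 𝒴                    ≤⟨ *-monoʳ-≤ (w + 1) (numEdges≤∑C2 G 𝒴-partition) ⟩
  (w + 1) * ∑[ Q ← 𝒴 ] (∣ Q ∩ ⊤ ∣ C 2)      ≡⟨ ∑-distribˡ-* 𝒴 (w + 1) _ ⟨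
  ∑[ Q ← 𝒴 ] ((w + 1) * (∣ Q ∩ ⊤ ∣ C 2))    ≤⟨ ∑-mono-All (parts-clique G 𝒴-partition) part-bound ⟩
  ∑[ Q ← 𝒴 ] (w * weight ∣ Q ∩ ⊤ ∣)         ≡⟨ ∑-distribˡ-* 𝒴 w _ ⟩
  w * potential G 𝒴-partition ⊤             ≤⟨ *-monoʳ-≤ w (potential≤2*numEdges G 𝒴-partition greedy) ⟩
  w * (2 * numEdges G 𝒳)                    ≡⟨ *-assoc w 2 (numEdges G 𝒳) ⟨
  w * 2 * numEdges G 𝒳                      ≡⟨ cong (_* numEdges G 𝒳) (*-comm w 2) ⟩
  2 * w * numEdges G 𝒳                      ∎
  where
  open ≤-Reasoning
  w : ℕ
  w = ω C 2
  part-bound : ∀ {Q} → IsClique G Q → (w + 1) * (∣ Q ∩ ⊤ ∣ C 2) ≤ w * weight ∣ Q ∩ ⊤ ∣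
  part-bound Q-clique = [w+1]*C2≤w*weight w _ (C2-mono (∣Q∩S∣≤ω G ω-cliqueNumber Q-clique))
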